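{- Let $P\subseteq\{1,2,3\}^k$ be a puzzle with $|P|=2$. If $P$ is a uniquely solvable puzzle, then $P$ is a strong uniquely solvable puzzle.
   Context: $[k]=\{1,\dots,k\}$. A puzzle of width $k$ is a finite set $P\subseteq\{1,2,3\}^k$ (elements are rows). $\mathrm{Sym}(P)$ is the group of permutations of $P$. $P$ is uniquely solvable if for all $\pi_1,\pi_2,\pi_3\in\mathrm{Sym}(P)$, either (i) $\pi_1=\pi_2=\pi_3$, or (ii) there exist $r\in P$ and $c\in[k]$ such that at least two of $(\pi_1(r))_c=1$, $(\pi_2(r))_c=2$, $(\pi_3(r))_c=3$ hold. $P$ is strong uniquely solvable if the same holds with "at least two" replaced by "exactly two". -}

module Defs where

open import Data.Nat using (ℕ; _+_; _≤_)
open import Data.Fin using (Fin; zero; suc)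
open import Data.Vec using (Vec; lookup)
open import Data.Bool using (Bool; true; false)
open import Data.Product using (_×_; ∃-syntax)
open import Data.Sum using (_⊎_)
open import Function.Definitions using (Injective)
open import Relation.Binary.PropositionalEquality using (_≡_)
open import Relation.Nullary.Decidable using (⌊_⌋)
open import Data.Fin.Permutation using (Permutation′; _⟨$⟩ʳ_)
import Data.Fin.Properties as FinP

-- Symbols 1,2,3 are encoded as the elements 0,1,2 of Fin 3.
Symbol : Set
Symbol = Fin 3

one two three : Symbol
one = zero
two = suc zero
three = suc (suc zero)

Row : ℕ → Set
Row k = Vec Symbol k

-- A puzzle of width k with n rows: a finite set P ⊆ {1,2,3}^k with |P| = n,
-- given by an injective enumeration of its rows.
record Puzzle (k n : ℕ) : Set where
  field
    row   : Fin n → Row k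
    inj   : Injective _≡_ _≡_ row

-- Sym(P): permutations of P, transported along the enumeration to Fin n.
Sym : ∀ {k n} → Puzzle k n → Set
Sym {n = n} _ = Permutation′ n

entry : ∀ {k n} (P : Puzzle k n) → Sym P → Fin n → Fin k → Symbol
entry P π i c = lookup (Puzzle.row P (π ⟨$⟩ʳ i)) c

count3 : Bool → Bool → Bool → ℕ
count3 a b c = b2n a + b2n b + b2n c
  where
  b2n : Bool → ℕ
  b2n true = 1
  b2n false = 0

hits : ∀ {k n} (P : Puzzle k n) (π₁ π₂ π₃ : Sym P) → Fin n → Fin k → ℕ
hits P π₁ π₂ π₃ i c =
  count3 ⌊ entry P π₁ i c FinP.≟ one ⌋
         ⌊ entry P π₂ i c FinP.≟ two ⌋
         ⌊ entry P π₃ i c FinP.≟ three ⌋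

AllEqual : ∀ {k n} (P : Puzzle k n) (π₁ π₂ π₃ : Sym P) → Set
AllEqual {n = n} P π₁ π₂ π₃ =
  (∀ (i : Fin n) → π₁ ⟨$⟩ʳ i ≡ π₂ ⟨$⟩ʳ i) × (∀ (i : Fin n) → π₂ ⟨$⟩ʳ i ≡ π₃ ⟨$⟩ʳ i)

UniquelySolvable : ∀ {k n} → Puzzle k n → Set
UniquelySolvable {k} {n} P = ∀ (π₁ π₂ π₃ : Sym P) →
  AllEqual P π₁ π₂ π₃ ⊎ (∃[ i ] ∃[ c ] (2 ≤ hits P π₁ π₂ π₃ i c))

StrongUniquelySolvable : ∀ {k n} → Puzzle k n → Set
StrongUniquelySolvable {k} {n} P = ∀ (π₁ π₂ π₃ : Sym P) →
  AllEqual P π₁ π₂ π₃ ⊎ (∃[ i ] ∃[ c ] (hits P π₁ π₂ π₃ i c ≡ 2))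

{-# OPTIONS --safe #-}
module Submission where

-- With only two rows, the three rows π₁ r, π₂ r, π₃ r cannot be distinct, so in
-- every column two of the three conditions concern the same symbol; as they ask
-- for different symbols, at most two conditions hold. Hence a column with at
-- least two hits has exactly two.

open import Defs
open import Data.Bool using (true; false)
open import Data.Nat using (ℕ; _≤_; z≤n; s≤s)
open import Data.Nat.Properties using (≤-antisym)
open import Data.Fin using (Fin; zero; suc)
open import Data.Vec using (lookup)
open import Data.Sum using (_⊎_; inj₁; inj₂; map₂)
open import Data.Product using (_,_)
open import Relation.Binary.PropositionalEquality using (_≡_; refl)
open import Relation.Nullary.Decidable using (⌊_⌋)
open import Data.Fin.Permutation using (_⟨$⟩ʳ_)
import Data.Fin.Properties as FinP

hitCount : Symbol → Symbol → Symbol → ℕ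
hitCount x y z = count3 ⌊ x FinP.≟ one ⌋ ⌊ y FinP.≟ two ⌋ ⌊ z FinP.≟ three ⌋

count3-falseˡ-≤2 : ∀ b c → count3 false b c ≤ 2
count3-falseˡ-≤2 true  true  = s≤s (s≤s z≤n)
count3-falseˡ-≤2 true  false = s≤s z≤n
count3-falseˡ-≤2 false true  = s≤s z≤n
count3-falseˡ-≤2 false false = z≤n

count3-falseᵐ-≤2 : ∀ a c → count3 a false c ≤ 2
count3-falseᵐ-≤2 true  true  = s≤s (s≤s z≤n)
count3-falseᵐ-≤2 true  false = s≤s z≤n
count3-falseᵐ-≤2 false true  = s≤s z≤n
count3-falseᵐ-≤2 false false = z≤n

count3-falseʳ-≤2 : ∀ a b → count3 a b false ≤ 2
count3-falseʳ-≤2 true  true  = s≤s (s≤s z≤n)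
count3-falseʳ-≤2 true  false = s≤s z≤n
count3-falseʳ-≤2 false true  = s≤s z≤n
count3-falseʳ-≤2 false false = z≤n

hitCount-xxz-≤2 : ∀ x z → hitCount x x z ≤ 2
hitCount-xxz-≤2 zero    z = count3-falseᵐ-≤2 true ⌊ z FinP.≟ three ⌋
hitCount-xxz-≤2 (suc x) z = count3-falseˡ-≤2 ⌊ suc x FinP.≟ two ⌋ ⌊ z FinP.≟ three ⌋

hitCount-xyy-≤2 : ∀ x y → hitCount x y y ≤ 2
hitCount-xyy-≤2 x zero             = count3-falseʳ-≤2 ⌊ x FinP.≟ one ⌋ false
hitCount-xyy-≤2 x (suc zero)       = count3-falseʳ-≤2 ⌊ x FinP.≟ one ⌋ true
hitCount-xyy-≤2 x (suc (suc zero)) = count3-falseᵐ-≤2 ⌊ x FinP.≟ one ⌋ true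

hitCount-xyx-≤2 : ∀ x y → hitCount x y x ≤ 2
hitCount-xyx-≤2 zero             y = count3-falseʳ-≤2 true ⌊ y FinP.≟ two ⌋
hitCount-xyx-≤2 (suc zero)       y = count3-falseʳ-≤2 false ⌊ y FinP.≟ two ⌋
hitCount-xyx-≤2 (suc (suc zero)) y = count3-falseˡ-≤2 ⌊ y FinP.≟ two ⌋ true

Fin2-three-not-distinct : (a b d : Fin 2) → a ≡ b ⊎ b ≡ d ⊎ a ≡ d
Fin2-three-not-distinct zero       zero       _          = inj₁ refl
Fin2-three-not-distinct (suc zero) (suc zero) _          = inj₁ refl
Fin2-three-not-distinct zero       (suc zero) (suc zero) = inj₂ (inj₁ refl)
Fin2-three-not-distinct (suc zero) zero       zero       = inj₂ (inj₁ refl)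
Fin2-three-not-distinct zero       (suc zero) zero       = inj₂ (inj₂ refl)
Fin2-three-not-distinct (suc zero) zero       (suc zero) = inj₂ (inj₂ refl)

hitCount-≤2 : ∀ {k} (row : Fin 2 → Row k) (c : Fin k) (a b d : Fin 2) →
              hitCount (lookup (row a) c) (lookup (row b) c) (lookup (row d) c) ≤ 2
hitCount-≤2 row c a b d with Fin2-three-not-distinct a b d
... | inj₁ refl        = hitCount-xxz-≤2 (lookup (row a) c) (lookup (row d) c)
... | inj₂ (inj₁ refl) = hitCount-xyy-≤2 (lookup (row a) c) (lookup (row b) c)
... | inj₂ (inj₂ refl) = hitCount-xyx-≤2 (lookup (row a) c) (lookup (row b) c)

hits-≤2 : ∀ {k} (P : Puzzle k 2) (π₁ π₂ π₃ : Sym P) (i : Fin 2) (c : Fin k) →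
           hits P π₁ π₂ π₃ i c ≤ 2
hits-≤2 P π₁ π₂ π₃ i c = hitCount-≤2 (Puzzle.row P) c (π₁ ⟨$⟩ʳ i) (π₂ ⟨$⟩ʳ i) (π₃ ⟨$⟩ʳ i)

corollary1 : (k : ℕ) (P : Puzzle k 2) → UniquelySolvable P → StrongUniquelySolvable P
corollary1 k P us π₁ π₂ π₃ =
  map₂ (λ { (i , c , twoHits) → i , c , ≤-antisym (hits-≤2 P π₁ π₂ π₃ i c) twoHits })
       (us π₁ π₂ π₃)
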